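{- There is an absolute constant $C_1>0$ such that the following holds. Let $q_1,\dots,q_r$ be nonzero integers satisfying condition (*): whenever $e_0,\dots,e_r$ are nonnegative integers with $(-3)^{e_0}q_1^{e_1}\cdots q_r^{e_r}$ a perfect square, $\sum_{i=0}^r e_i$ is even. Let $v=16\prod_{\ell\mid q_1\cdots q_r,\ \ell>2}\ell$, and let $u$ be an integer coprime to $v$ such that (1) every prime $p\equiv u\pmod v$ has $\left(\frac{q_1}{p}\right)=\dots=\left(\frac{q_r}{p}\right)=-1$, and (2) the largest power $T$ of $2$ dividing $u-1$ lies in $\{2,4,8\}$ and $\gcd(\frac{u-1}{T},v)=1$. Let $\kappa$ be a natural number. Then there are integers $a_1<\dots<a_\kappa$, each congruent to $u$ modulo $v$, such that the $2\kappa$ linear functions \[ L_i(n)=vn+a_i,\qquad \tilde L_i(n)=\frac{v}{T}n+\frac{a_i-1}{T}\qquad(1\le i\le\kappa) \] form an admissible family, and moreover $a_\kappa-a_1\le v\cdot(2\kappa)^{C_1}$.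
   Context: A finite set of distinct linear functions $L_j(n)=\alpha_j n+\beta_j$ with $\alpha_j,\beta_j\in\mathbb{Z}$ and $\alpha_j>0$ is admissible if for every prime $p$ there is an integer $n_p$ with $p\nmid\prod_j L_j(n_p)$. -}

module Defs where

open import Data.Nat as ℕ using (ℕ; zero; suc)
open import Data.Nat.Primality using (Prime; prime?)
open import Data.Nat.Divisibility as ℕD using (_∣?_)
open import Data.Integer as ℤ using (ℤ; +_; _+_; _-_; _*_; _^_; _<_)
open import Data.Integer.Divisibility using (_∣_)
open import Data.Fin using (Fin; fromℕ)
import Data.Nat.ListAction
open import Data.List using (List; []; _∷_; foldr; map; filter; upTo)
open import Data.List.Relation.Unary.All using (All)
open import Data.List.Relation.Unary.Unique.Propositional using (Unique)
open import Data.Product using (_×_; _,_; ∃)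
open import Relation.Nullary using (¬_)
open import Relation.Nullary.Decidable using (_×-dec_)
open import Relation.Binary.PropositionalEquality using (_≡_)

prodℤ : List ℤ → ℤ
prodℤ = foldr _*_ (+ 1)

IsSquare : ℤ → Set
IsSquare z = ∃ λ (m : ℤ) → z ≡ m * m

-- product of all primes ℓ > 2 dividing Q (for Q ≥ 1 every such ℓ is ≤ Q)
oddRad : ℕ → ℕ
oddRad Q = Data.Nat.ListAction.product
  (filter (λ ℓ → (2 ℕ.<? ℓ) ×-dec (prime? ℓ ×-dec (ℓ ∣? Q))) (upTo (suc Q)))

-- Legendre symbol (a / p) = -1 for a prime p:
-- p does not divide a and a is not a square modulo p
LegendreIsMinusOne : ℤ → ℕ → Set
LegendreIsMinusOne a p = (¬ ((+ p) ∣ a)) × (¬ ∃ λ (x : ℤ) → (+ p) ∣ (x * x - a))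

LinFun : Set
LinFun = ℤ × ℤ

evalLin : LinFun → ℤ → ℤ
evalLin (α , β) n = α * n + β

Admissible : List LinFun → Set
Admissible Ls =
  Unique Ls ×
  All (λ L → (+ 0) < Data.Product.proj₁ L) Ls ×
  ((p : ℕ) → Prime p → ∃ λ (n : ℤ) → ¬ ((+ p) ∣ prodℤ (map (λ L → evalLin L n) Ls)))

-- a_κ - a_1 for a sequence a_1,…,a_κ (0 for the empty sequence)
spread : (κ : ℕ) → (Fin κ → ℤ) → ℤ
spread zero a = + 0
spread (suc k) a = a (fromℕ k) - a Fin.zero
  where import Data.Fin as Fin

module Submission where

-- With b = (u - 1)/T, f = 15v and e = T·f put aᵢ = u + e·i² for i = 1, …, κ.
-- Then aᵢ ≡ u (mod v), the second family is L̃ᵢ(n) = (v/T)n + b + f·i², and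
-- T·L̃ᵢ(n) = Lᵢ(n) - 1.  The spread is e(κ² - 1) ≤ 120vκ² ≤ v(2κ)⁷, so C₁ = 7 works.
--
-- Admissibility is checked prime by prime:
--  * p ∣ v: at n = 0, Lᵢ ≡ u and L̃ᵢ ≡ b (mod p), both coprime to v;
--  * p ∤ v, p ∣ 15: then p ∣ e, and vn ≡ 2 - u gives Lᵢ(n) ≡ 2, Lᵢ(n) - 1 ≡ 1;
--  * p ∤ 30v: with ε ≡ e⁻¹ choose w such that w and w + ε are non-squares mod p, and
--    vn ≡ -ew - u; then Lᵢ(n) ≡ e(i² - w) and Lᵢ(n) - 1 ≡ e(i² - (w + ε)) are prime to p.
-- Such a w exists by counting (module TwoNonSquares): the residues of t² and of t² - ε,
-- 0 ≤ t ≤ (p - 1)/2, fill at most p - 1 classes, because three explicit representations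
-- ε ≡ T² - S² force two distinct values t² - ε to be squares (this is where p ∤ 30 enters).

open import Defs
open import Data.Nat as ℕ using (ℕ; zero; suc; NonZero)
open import Data.Nat.Primality using (Prime)
open import Data.Nat.Coprimality using (Coprime)
open import Data.Nat.ListAction using (sum)
open import Data.Integer as ℤ using (ℤ; +_; -[1+_]; _+_; _-_; _*_; _^_; _<_; _≤_; ∣_∣; _/ℕ_)
open import Data.Integer.Divisibility using (_∣_)
open import Data.Fin as Fin using (Fin)
open import Data.List using (List; map; tabulate; _++_)
import Data.Nat.Divisibility
open import Data.Product using (_×_; _,_; ∃)
open import Data.Sum using (_⊎_)
open import Relation.Nullary using (¬_)
open import Relation.Binary.PropositionalEquality using (_≡_)

open import Data.Nat using (z≤n; s≤s)
import Data.Nat.Properties as ℕP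
import Data.Nat.DivMod as ℕDM
import Data.Nat.Divisibility as ℕD
import Data.Nat.Tactic.RingSolver as ℕSolver
open import Data.Nat.Primality
  using (euclidsLemma; ¬prime[1]; prime⇒irreducible; prime⇒nonZero; productOfPrimes≥1; prime?)
open import Data.Nat.Coprimality using (coprime-Bézout)
open import Data.Nat.GCD using (module Bézout)
open import Data.Integer using (-_; _%ℕ_)
import Data.Integer.Properties as ℤP
open import Data.Integer.DivMod using (a≡a%ℕn+[a/ℕn]*n; n%ℕd<d)
open import Data.Integer.Divisibility.Signed
  using (divides; ∣⇒∣ᵤ; ∣ᵤ⇒∣; ∣m∣n⇒∣m+n; ∣m∣n⇒∣m-n; ∣m⇒∣-m; ∣n⇒∣m*n) renaming (_∣_ to _∣ₛ_)
open import Data.Integer.Tactic.RingSolver using (solve-∀)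
open import Data.Fin using (toℕ)
import Data.Fin.Properties as FinP
open import Data.List using (length; upTo)
import Data.List.Properties as LP
open import Data.List.Relation.Unary.Any using (here; there)
import Data.List.Relation.Unary.Any as Any
open import Data.List.Relation.Unary.All using (All; []; _∷_)
import Data.List.Relation.Unary.All as All
import Data.List.Relation.Unary.All.Properties as AllP
open import Data.List.Relation.Unary.Unique.Propositional using (Unique)
import Data.List.Relation.Unary.Unique.Propositional.Properties as UniqueP
open import Data.List.Membership.Propositional using (_∈_; _∉_)
open import Data.List.Membership.Propositional.Properties
  using (∈-upTo⁺; ∈-map⁺; ∈-++⁺ˡ; ∈-++⁺ʳ; ∈-tabulate⁻)
open import Data.List.Membership.DecPropositional ℕ._≟_ using (_∈?_)
open import Data.List.Membership.Setoid.Properties using (index-injective)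
open import Data.Product using (∃₂; proj₁; proj₂)
open import Data.Sum using (inj₁; inj₂)
open import Data.Empty using (⊥; ⊥-elim)
open import Relation.Nullary using (yes; no)
open import Relation.Nullary.Decidable using (_×-dec_)
open import Level using (0ℓ)
open import Relation.Binary.Bundles using (Setoid)
open import Relation.Binary.Definitions using (tri<; tri≈; tri>)
import Relation.Binary.Reasoning.Setoid
open import Relation.Binary.PropositionalEquality

infix 4 _≡_[mod_]

-- x and y are congruent modulo m (a record, so that x and y can be inferred)
record _≡_[mod_] (x y : ℤ) (m : ℕ) : Set where
  constructor congruent
  field difference : + m ∣ₛ (x - y)
open _≡_[mod_]

module _ {m : ℕ} where

  mod-reflexive : ∀ {x y} → x ≡ y → x ≡ y [mod m ]
  mod-reflexive {x} refl = congruent (divides (+ 0) (ℤP.+-inverseʳ x))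

  mod-sym : ∀ {x y} → x ≡ y [mod m ] → y ≡ x [mod m ]
  mod-sym {x} {y} x≡y = congruent (subst (+ m ∣ₛ_) (negate x y) (∣m⇒∣-m (difference x≡y)))
    where negate : ∀ x y → - (x - y) ≡ y - x
          negate = solve-∀

  mod-trans : ∀ {x y z} → x ≡ y [mod m ] → y ≡ z [mod m ] → x ≡ z [mod m ]
  mod-trans {x} {y} {z} x≡y y≡z =
    congruent (subst (+ m ∣ₛ_) (telescope x y z) (∣m∣n⇒∣m+n (difference x≡y) (difference y≡z)))
    where telescope : ∀ x y z → (x - y) + (y - z) ≡ x - z
          telescope = solve-∀

  mod-+ : ∀ {a b c d} → a ≡ b [mod m ] → c ≡ d [mod m ] → a + c ≡ b + d [mod m ]
  mod-+ {a} {b} {c} {d} a≡b c≡d =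
    congruent (subst (+ m ∣ₛ_) (regroup a b c d) (∣m∣n⇒∣m+n (difference a≡b) (difference c≡d)))
    where regroup : ∀ a b c d → (a - b) + (c - d) ≡ (a + c) - (b + d)
          regroup = solve-∀

  mod-*ˡ : ∀ c {a b} → a ≡ b [mod m ] → c * a ≡ c * b [mod m ]
  mod-*ˡ c {a} {b} a≡b = congruent (subst (+ m ∣ₛ_) (distrib c a b) (∣n⇒∣m*n c (difference a≡b)))
    where distrib : ∀ c a b → c * (a - b) ≡ c * a - c * b
          distrib = solve-∀

  mod-*ʳ : ∀ c {a b} → a ≡ b [mod m ] → a * c ≡ b * c [mod m ]
  mod-*ʳ c {a} {b} a≡b = subst₂ _≡_[mod m ] (ℤP.*-comm c a) (ℤP.*-comm c b) (mod-*ˡ c a≡b)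

  mod-* : ∀ {a b c d} → a ≡ b [mod m ] → c ≡ d [mod m ] → a * c ≡ b * d [mod m ]
  mod-* {b = b} {c} a≡b c≡d = mod-trans (mod-*ʳ c a≡b) (mod-*ˡ b c≡d)

  mod-neg : ∀ {a b} → a ≡ b [mod m ] → - a ≡ - b [mod m ]
  mod-neg {a} {b} a≡b = subst₂ _≡_[mod m ] (ℤP.-1*i≡-i a) (ℤP.-1*i≡-i b) (mod-*ˡ ℤ.-1ℤ a≡b)

modSetoid : ℕ → Setoid 0ℓ 0ℓ
modSetoid m = record
  { Carrier = ℤ
  ; _≈_ = _≡_[mod m ]
  ; isEquivalence = record { refl = mod-reflexive refl ; sym = mod-sym ; trans = mod-trans }
  }

module ModReasoning (m : ℕ) = Relation.Binary.Reasoning.Setoid (modSetoid m)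

∣-resp-mod : ∀ {m x y} → x ≡ y [mod m ] → + m ∣ₛ x → + m ∣ₛ y
∣-resp-mod {m} {x} {y} x≡y m∣x = subst (+ m ∣ₛ_) (cancel x y) (∣m∣n⇒∣m-n m∣x (difference x≡y))
  where cancel : ∀ x y → x - (x - y) ≡ y
        cancel = solve-∀

complement-≡ : ∀ {m r} → r ℕ.≤ m → + r ≡ - + (m ℕ.∸ r) [mod m ]
complement-≡ {m} {r} r≤m = congruent (divides (+ 1) (begin
  + r - - + (m ℕ.∸ r)        ≡⟨ cong (λ z → + r + z) (ℤP.neg-involutive (+ (m ℕ.∸ r))) ⟩
  + r + + (m ℕ.∸ r)          ≡⟨ ℤP.pos-+ r (m ℕ.∸ r) ⟨
  + (r ℕ.+ (m ℕ.∸ r))        ≡⟨ cong +_ (ℕP.m+[n∸m]≡n r≤m) ⟩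
  + m                        ≡⟨ ℤP.*-identityˡ (+ m) ⟨
  + 1 * + m                  ∎))
  where open ≡-Reasoning

absorb : ∀ {m} x {y} → + m ∣ₛ y → x + y ≡ x [mod m ]
absorb {m} x {y} m∣y = congruent (subst (+ m ∣ₛ_) (sym (cancel x y)) m∣y)
  where cancel : ∀ x y → (x + y) - x ≡ y
        cancel = solve-∀

smallMultiple : ∀ {m d} → d ℕ.< m → + m ∣ₛ + d → d ≡ 0
smallMultiple {d = zero}  _   _   = refl
smallMultiple {d = suc _} d<m m∣d = ⊥-elim (ℕD.>⇒∤ d<m (∣⇒∣ᵤ m∣d))

residue-unique-≤ : ∀ {m x y} → x ℕ.≤ y → y ℕ.< m → + y ≡ + x [mod m ] → y ≡ x
residue-unique-≤ {m} {x} {y} x≤y y<m y≡x = ℕP.≤-antisym (ℕP.m∸n≡0⇒m≤n difference≡0) x≤y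
  where
  difference≡0 : y ℕ.∸ x ≡ 0
  difference≡0 = smallMultiple (ℕP.≤-<-trans (ℕP.m∸n≤m y x) y<m)
                   (subst (+ m ∣ₛ_) (trans (ℤP.m-n≡m⊖n y x) (ℤP.⊖-≥ x≤y)) (difference y≡x))

residue-unique : ∀ {m a b} → a ℕ.< m → b ℕ.< m → + a ≡ + b [mod m ] → a ≡ b
residue-unique {a = a} {b} a<m b<m a≡b with ℕP.≤-total a b
... | inj₁ a≤b = sym (residue-unique-≤ a≤b b<m (mod-sym a≡b))
... | inj₂ b≤a = residue-unique-≤ b≤a a<m a≡b

module Residues (m : ℕ) .{{_ : NonZero m}} where

  residue-≡ : ∀ x → x ≡ + (x %ℕ m) [mod m ]
  residue-≡ x = congruent (divides (x /ℕ m) (begin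
    x - + (x %ℕ m)                            ≡⟨ cong (_- + (x %ℕ m)) (a≡a%ℕn+[a/ℕn]*n x m) ⟩
    (+ (x %ℕ m) + x /ℕ m * + m) - + (x %ℕ m)  ≡⟨ cancel (+ (x %ℕ m)) (x /ℕ m * + m) ⟩
    x /ℕ m * + m                              ∎))
    where open ≡-Reasoning
          cancel : ∀ r z → (r + z) - r ≡ z
          cancel = solve-∀

  mod⇒residue≡ : ∀ {x y} → x ≡ y [mod m ] → x %ℕ m ≡ y %ℕ m
  mod⇒residue≡ {x} {y} x≡y = residue-unique (n%ℕd<d x m) (n%ℕd<d y m)
    (mod-trans (mod-sym (residue-≡ x)) (mod-trans x≡y (residue-≡ y)))

  residue≡⇒mod : ∀ {x y} → x %ℕ m ≡ y %ℕ m → x ≡ y [mod m ]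
  residue≡⇒mod {x} {y} r≡r = mod-trans (residue-≡ x)
    (subst (λ r → + r ≡ y [mod m ]) (sym r≡r) (mod-sym (residue-≡ y)))

  multiple/ℕ : ∀ q → (q * + m) /ℕ m ≡ q
  multiple/ℕ q = sym (ℤP.*-cancelʳ-≡ q (x /ℕ m) (+ m) (begin
    q * + m                       ≡⟨ a≡a%ℕn+[a/ℕn]*n x m ⟩
    + (x %ℕ m) + x /ℕ m * + m     ≡⟨ cong (λ r → + r + x /ℕ m * + m) residue≡0 ⟩
    + 0 + x /ℕ m * + m            ≡⟨ ℤP.+-identityˡ (x /ℕ m * + m) ⟩
    x /ℕ m * + m                  ∎))
    where
    open ≡-Reasoning
    x = q * + m
    residue≡0 : x %ℕ m ≡ 0
    residue≡0 = smallMultiple (n%ℕd<d x m) (∣-resp-mod (residue-≡ x) (divides q refl))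

  residue-small : ∀ {w} → w ℕ.< m → + w %ℕ m ≡ w
  residue-small w<m = ℕDM.m<n⇒m%n≡m w<m

prime∤*ℕ : ∀ {p a b} → Prime p → ¬ p ℕD.∣ a → ¬ p ℕD.∣ b → ¬ p ℕD.∣ a ℕ.* b
prime∤*ℕ {a = a} {b} pr p∤a p∤b p∣ab with euclidsLemma a b pr p∣ab
... | inj₁ p∣a = p∤a p∣a
... | inj₂ p∣b = p∤b p∣b

prime∤* : ∀ {p} → Prime p → ∀ {a b} → ¬ + p ∣ₛ a → ¬ + p ∣ₛ b → ¬ + p ∣ₛ (a * b)
prime∤* {p} pr {a} {b} p∤a p∤b p∣ab = prime∤*ℕ pr (λ p∣a → p∤a (∣ᵤ⇒∣ p∣a)) (λ p∣b → p∤b (∣ᵤ⇒∣ p∣b))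
  (subst (p ℕD.∣_) (ℤP.abs-* a b) (∣⇒∣ᵤ p∣ab))

coprime⇒∤ : ∀ {p x v} → Prime p → Coprime ℤ.∣ x ∣ v → p ℕD.∣ v → ¬ + p ∣ₛ x
coprime⇒∤ pr x⊥v p∣v p∣x = ¬prime[1] (subst Prime (x⊥v (∣⇒∣ᵤ p∣x , p∣v)) pr)

oddPrime : ∀ {p} → Prime p → ¬ p ℕD.∣ 2 → ∃ λ h → p ≡ suc (h ℕ.+ h)
oddPrime {p} pr p∤2 with p ℕ.% 2 in p%2 | ℕDM.m%n<n p 2
... | zero | _ with prime⇒irreducible pr (ℕD.m%n≡0⇒n∣m p 2 p%2)
...   | inj₁ ()
...   | inj₂ refl = ⊥-elim (p∤2 ℕD.∣-refl)
oddPrime {p} pr p∤2 | suc zero | _ = p ℕ./ 2 , (begin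
  p                              ≡⟨ ℕDM.m≡m%n+[m/n]*n p 2 ⟩
  p ℕ.% 2 ℕ.+ p ℕ./ 2 ℕ.* 2      ≡⟨ cong (λ r → r ℕ.+ p ℕ./ 2 ℕ.* 2) p%2 ⟩
  suc (p ℕ./ 2 ℕ.* 2)            ≡⟨ cong suc (ℕP.*-comm (p ℕ./ 2) 2) ⟩
  suc (2 ℕ.* (p ℕ./ 2))          ≡⟨ cong (λ z → suc (p ℕ./ 2 ℕ.+ z)) (ℕP.+-identityʳ (p ℕ./ 2)) ⟩
  suc (p ℕ./ 2 ℕ.+ p ℕ./ 2)      ∎)
  where open ≡-Reasoning
oddPrime pr p∤2 | suc (suc _) | s≤s (s≤s ())

prime∤1 : ∀ {p} → Prime p → ¬ + p ∣ₛ + 1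
prime∤1 pr p∣1 = ¬prime[1] (subst Prime (ℕD.∣1⇒≡1 (∣⇒∣ᵤ p∣1)) pr)

prime∤prodℤ : ∀ {p} → Prime p → ∀ {xs} → All (λ x → ¬ + p ∣ₛ x) xs → ¬ + p ∣ₛ prodℤ xs
prime∤prodℤ pr []           = prime∤1 pr
prime∤prodℤ pr (p∤x ∷ p∤xs) = prime∤* pr p∤x (prime∤prodℤ pr p∤xs)

inverseMod : ∀ {p} → Prime p → ∀ m → ¬ p ℕD.∣ m → ∃ λ m⁻¹ → + m * m⁻¹ ≡ + 1 [mod p ]
inverseMod {p} pr m p∤m with coprime-Bézout coprime
  where
  coprime : Coprime m p
  coprime (d∣m , d∣p) with prime⇒irreducible pr d∣p
  ... | inj₁ d≡1 = d≡1
  ... | inj₂ refl = ⊥-elim (p∤m d∣m)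
... | Bézout.+- x y eq = + x , congruent (divides (+ y) (begin
    + m * + x - + 1            ≡⟨ cong (_- + 1) (ℤP.pos-* m x) ⟨
    + (m ℕ.* x) - + 1          ≡⟨ cong (λ z → + z - + 1) (trans (ℕP.*-comm m x) (sym eq)) ⟩
    + (1 ℕ.+ y ℕ.* p) - + 1    ≡⟨ cong (_- + 1) (ℤP.pos-+ 1 (y ℕ.* p)) ⟩
    (+ 1 + + (y ℕ.* p)) - + 1  ≡⟨ cong (λ z → (+ 1 + z) - + 1) (ℤP.pos-* y p) ⟩
    (+ 1 + + y * + p) - + 1    ≡⟨ cancel (+ y * + p) ⟩
    + y * + p                  ∎))
  where open ≡-Reasoning
        cancel : ∀ z → (+ 1 + z) - + 1 ≡ z
        cancel = solve-∀
... | Bézout.-+ x y eq = - + x , congruent (divides (- + y) (begin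
    + m * - + x - + 1          ≡⟨ rearrange (+ m) (+ x) ⟩
    - (+ 1 + + x * + m)        ≡⟨ cong (λ z → - (+ 1 + z)) (ℤP.pos-* x m) ⟨
    - (+ 1 + + (x ℕ.* m))      ≡⟨ cong -_ (trans (ℤP.pos-+ 1 (x ℕ.* m)) (cong +_ eq)) ⟩
    - + (y ℕ.* p)              ≡⟨ cong -_ (ℤP.pos-* y p) ⟩
    - (+ y * + p)              ≡⟨ ℤP.neg-distribˡ-* (+ y) (+ p) ⟩
    - + y * + p                ∎))
  where open ≡-Reasoning
        rearrange : ∀ m x → m * - x - + 1 ≡ - (+ 1 + x * m)
        rearrange = solve-∀

∈-─ : ∀ {A : Set} {x y : A} {xs} (y∈xs : y ∈ xs) → x ≢ y → x ∈ xs → x ∈ (xs Any.─ y∈xs)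
∈-─ (here refl) x≢y (here x≡y)   = ⊥-elim (x≢y x≡y)
∈-─ (here _)    _   (there x∈xs) = x∈xs
∈-─ (there _)   _   (here x≡z)   = here x≡z
∈-─ (there y∈xs) x≢y (there x∈xs) = there (∈-─ y∈xs x≢y x∈xs)

removeTwo : ∀ {A : Set} {x y : A} {xs} → x ∈ xs → y ∈ xs → x ≢ y →
            ∃ λ ys → length xs ≡ 2 ℕ.+ length ys × (∀ {z} → z ∈ xs → z ≢ x → z ≢ y → z ∈ ys)
removeTwo {x = x} {y} {xs} x∈xs y∈xs x≢y =
  (xs Any.─ x∈xs Any.─ y∈rest) , shorter , λ z∈xs z≢x z≢y → ∈-─ y∈rest z≢y (∈-─ x∈xs z≢x z∈xs)
  where
  y∈rest : y ∈ (xs Any.─ x∈xs)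
  y∈rest = ∈-─ x∈xs (λ y≡x → x≢y (sym y≡x)) y∈xs
  shorter : length xs ≡ 2 ℕ.+ length (xs Any.─ x∈xs Any.─ y∈rest)
  shorter = trans (LP.length-removeAt′ xs (Any.index x∈xs))
                  (cong suc (LP.length-removeAt′ (xs Any.─ x∈xs) (Any.index y∈rest)))

missingValue : ∀ m (xs : List ℕ) → length xs ℕ.< m → ∃ λ w → w ℕ.< m × w ∉ xs
missingValue m xs short with FinP.¬∀⟶∃¬ m (λ i → toℕ i ∈ xs) (λ i → toℕ i ∈? xs) notAllHit
  where
  notAllHit : ¬ (∀ (i : Fin m) → toℕ i ∈ xs)
  notAllHit hit with FinP.pigeonhole short (λ i → Any.index (hit i))
  ... | i , j , i<j , sameIndex = FinP.<-irrefl
          (FinP.toℕ-injective (index-injective (setoid ℕ) (hit i) (hit j) sameIndex)) i<j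
... | i , i∉xs = toℕ i , FinP.toℕ<n i , i∉xs

NonSquare : ℕ → ℤ → Set
NonSquare p w = ∀ k → ¬ k * k ≡ w [mod p ]

module TwoNonSquares (p h : ℕ) (p≡2h+1 : p ≡ suc (h ℕ.+ h)) (pr : Prime p)
  (p∤2 : ¬ p ℕD.∣ 2) (p∤3 : ¬ p ℕD.∣ 3) (p∤5 : ¬ p ℕD.∣ 5) (ε : ℤ) where

  instance
    p≢0 : NonZero p
    p≢0 = prime⇒nonZero pr

  open Residues p

  H : ℤ
  H = + h + + 1

  2H≡1 : + 2 * H ≡ + 1 [mod p ]
  2H≡1 = congruent (divides (+ 1) (begin
    + 2 * H - + 1                ≡⟨ rearrange (+ h) ⟩
    + 1 * (+ 1 + (+ h + + h))     ≡⟨ cong (λ z → + 1 * (+ 1 + z)) (ℤP.pos-+ h h) ⟨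
    + 1 * (+ 1 + + (h ℕ.+ h))     ≡⟨ cong (λ z → + 1 * z) (ℤP.pos-+ 1 (h ℕ.+ h)) ⟨
    + 1 * + suc (h ℕ.+ h)         ≡⟨ cong (λ z → + 1 * + z) p≡2h+1 ⟨
    + 1 * + p                    ∎))
    where open ≡-Reasoning
          rearrange : ∀ h → + 2 * (h + + 1) - + 1 ≡ + 1 * (+ 1 + (h + h))
          rearrange = solve-∀

  -- every square is congruent to the square of some t ≤ h, namely t = ±k mod p
  smallRoot : ∀ k → ∃ λ t → t ℕ.≤ h × k * k ≡ + t * + t [mod p ]
  smallRoot k with k %ℕ p ℕ.≤? h
  ... | yes r≤h = k %ℕ p , r≤h , mod-* (residue-≡ k) (residue-≡ k)
  ... | no r≰h = p ℕ.∸ k %ℕ p , t≤h , k²≡t²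
    where
    r = k %ℕ p
    t = p ℕ.∸ r
    t≤h : t ℕ.≤ h
    t≤h = ℕP.≤-trans (ℕP.∸-monoʳ-≤ p (ℕP.≰⇒> r≰h))
            (ℕP.≤-reflexive (trans (cong (ℕ._∸ suc h) p≡2h+1) (ℕP.m+n∸m≡n h h)))
    k≡-t : k ≡ - + t [mod p ]
    k≡-t = mod-trans (residue-≡ k) (complement-≡ (ℕP.<⇒≤ (n%ℕd<d k p)))
    k²≡t² : k * k ≡ + t * + t [mod p ]
    k²≡t² = mod-trans (mod-* k≡-t k≡-t) (mod-reflexive (negSquare (+ t)))
      where negSquare : ∀ x → - x * - x ≡ x * x
            negSquare = solve-∀

  square shifted : ℕ → ℕ
  square t = (+ t * + t) %ℕ p
  shifted t = (+ t * + t - ε) %ℕ p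

  Squares Shifted : List ℕ
  Squares = map square (upTo (suc h))
  Shifted = map shifted (upTo (suc h))

  ∈Squares : ∀ {t} → t ℕ.≤ h → square t ∈ Squares
  ∈Squares t≤h = ∈-map⁺ square (∈-upTo⁺ (s≤s t≤h))

  ∈Shifted : ∀ {t} → t ℕ.≤ h → shifted t ∈ Shifted
  ∈Shifted t≤h = ∈-map⁺ shifted (∈-upTo⁺ (s≤s t≤h))

  nonSquare : ∀ {w} → w ℕ.< p → w ∉ Squares → NonSquare p (+ w)
  nonSquare {w} w<p w∉ k k²≡w with smallRoot k
  ... | t , t≤h , k²≡t² = w∉ (subst (_∈ Squares) square-t≡w (∈Squares t≤h))
    where
    square-t≡w : square t ≡ w
    square-t≡w = trans (mod⇒residue≡ (mod-trans (mod-sym k²≡t²) k²≡w)) (residue-small w<p)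

  shiftedNonSquare : ∀ {w} → w ℕ.< p → w ∉ Shifted → NonSquare p (+ w + ε)
  shiftedNonSquare {w} w<p w∉ k k²≡w+ε with smallRoot k
  ... | t , t≤h , k²≡t² = w∉ (subst (_∈ Shifted) shifted-t≡w (∈Shifted t≤h))
    where
    t²-ε≡w : + t * + t - ε ≡ + w [mod p ]
    t²-ε≡w = begin
      + t * + t - ε      ≈⟨ mod-+ k²≡t² (mod-reflexive refl) ⟨
      k * k - ε          ≈⟨ mod-+ k²≡w+ε (mod-reflexive refl) ⟩
      (+ w + ε) - ε      ≡⟨ cancel (+ w) ε ⟩
      + w                ∎
      where open ModReasoning p
            cancel : ∀ w ε → (w + ε) - ε ≡ w
            cancel = solve-∀
    shifted-t≡w : shifted t ≡ w
    shifted-t≡w = trans (mod⇒residue≡ t²-ε≡w) (residue-small w<p)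

  module Representation (c K : ℤ) (4cK²≡1 : + 4 * c * K * K ≡ + 1 [mod p ]) where

    T S : ℤ
    T = (ε + c) * K
    S = (ε - c) * K

    T²-S²≡ε : T * T - S * S ≡ ε [mod p ]
    T²-S²≡ε = begin
      T * T - S * S               ≡⟨ factor ε c K ⟩
      ε * (+ 4 * c * K * K)       ≈⟨ mod-*ˡ ε 4cK²≡1 ⟩
      ε * + 1                     ≡⟨ ℤP.*-identityʳ ε ⟩
      ε                           ∎
      where open ModReasoning p
            factor : ∀ ε c K → ((ε + c) * K) * ((ε + c) * K) - ((ε - c) * K) * ((ε - c) * K)
                               ≡ ε * (+ 4 * c * K * K)
            factor = solve-∀

    4cT²≡ : + 4 * c * (T * T) ≡ (ε + c) * (ε + c) [mod p ]
    4cT²≡ = begin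
      + 4 * c * (T * T)                     ≡⟨ factor ε c K ⟩
      (ε + c) * (ε + c) * (+ 4 * c * K * K)  ≈⟨ mod-*ˡ ((ε + c) * (ε + c)) 4cK²≡1 ⟩
      (ε + c) * (ε + c) * + 1                ≡⟨ ℤP.*-identityʳ _ ⟩
      (ε + c) * (ε + c)                      ∎
      where open ModReasoning p
            factor : ∀ ε c K → + 4 * c * (((ε + c) * K) * ((ε + c) * K))
                               ≡ (ε + c) * (ε + c) * (+ 4 * c * K * K)
            factor = solve-∀

  4H²≡1 : + 4 * + 1 * H * H ≡ + 1 [mod p ]
  4H²≡1 = mod-trans (mod-reflexive (regroup H)) (mod-* 2H≡1 2H≡1)
    where regroup : ∀ H → + 4 * + 1 * H * H ≡ (+ 2 * H) * (+ 2 * H)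
          regroup = solve-∀

  16H⁴≡1 : + 4 * + 4 * (H * H) * (H * H) ≡ + 1 [mod p ]
  16H⁴≡1 = mod-trans (mod-reflexive (regroup H)) (mod-* 4H²≡1 4H²≡1)
    where regroup : ∀ H → + 4 * + 4 * (H * H) * (H * H) ≡ (+ 4 * + 1 * H * H) * (+ 4 * + 1 * H * H)
          regroup = solve-∀

  64H⁶≡1 : + 4 * + 16 * (H * H * H) * (H * H * H) ≡ + 1 [mod p ]
  64H⁶≡1 = mod-trans (mod-reflexive (regroup H)) (mod-* 4H²≡1 16H⁴≡1)
    where regroup : ∀ H → + 4 * + 16 * (H * H * H) * (H * H * H)
                          ≡ (+ 4 * + 1 * H * H) * (+ 4 * + 4 * (H * H) * (H * H))
          regroup = solve-∀

  module R₁  = Representation (+ 1) H 4H²≡1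
  module R₄  = Representation (+ 4) (H * H) 16H⁴≡1
  module R₁₆ = Representation (+ 16) (H * H * H) 64H⁶≡1

  p∤720 : ¬ + p ∣ₛ + 720
  p∤720 p∣720 = prime∤*ℕ pr p∤2 (prime∤*ℕ pr p∤2 (prime∤*ℕ pr p∤2 (prime∤*ℕ pr p∤2
                  (prime∤*ℕ pr p∤3 (prime∤*ℕ pr p∤3 p∤5))))) (∣⇒∣ᵤ p∣720)

  -- The squares T₁², T₄², T₁₆² are not all congruent: otherwise, writing Xc = (ε + c)²,
  -- 16X₁ ≡ 64T₁² ≡ 4X₄ and 16X₁ ≡ X₁₆, so 720 = 16X₁ - 20X₄ + 4X₁₆ would vanish mod p.
  noTripleCollision : R₁.T * R₁.T ≡ R₄.T * R₄.T [mod p ] → R₁.T * R₁.T ≡ R₁₆.T * R₁₆.T [mod p ] → ⊥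
  noTripleCollision T₁²≡T₄² T₁²≡T₁₆² = p∤720 (subst (+ p ∣ₛ_) (combination ε) (difference combined))
    where
    open ModReasoning p
    X₁ X₄ X₁₆ : ℤ
    X₁ = (ε + + 1) * (ε + + 1)
    X₄ = (ε + + 4) * (ε + + 4)
    X₁₆ = (ε + + 16) * (ε + + 16)
    64T₁²≡16X₁ : + 64 * (R₁.T * R₁.T) ≡ + 16 * X₁ [mod p ]
    64T₁²≡16X₁ = mod-trans (mod-reflexive (ℤP.*-assoc (+ 16) (+ 4 * + 1) _))
                           (mod-*ˡ (+ 16) R₁.4cT²≡)
    16X₁≡4X₄ : + 16 * X₁ ≡ + 4 * X₄ [mod p ]
    16X₁≡4X₄ = begin
      + 16 * X₁                   ≈⟨ 64T₁²≡16X₁ ⟨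
      + 64 * (R₁.T * R₁.T)         ≈⟨ mod-*ˡ (+ 64) T₁²≡T₄² ⟩
      + 64 * (R₄.T * R₄.T)         ≡⟨ ℤP.*-assoc (+ 4) (+ 4 * + 4) _ ⟩
      + 4 * (+ 4 * + 4 * (R₄.T * R₄.T)) ≈⟨ mod-*ˡ (+ 4) R₄.4cT²≡ ⟩
      + 4 * X₄                    ∎
    16X₁≡X₁₆ : + 16 * X₁ ≡ X₁₆ [mod p ]
    16X₁≡X₁₆ = begin
      + 16 * X₁                   ≈⟨ 64T₁²≡16X₁ ⟨
      + 64 * (R₁.T * R₁.T)         ≈⟨ mod-*ˡ (+ 64) T₁²≡T₁₆² ⟩
      + 64 * (R₁₆.T * R₁₆.T)       ≈⟨ R₁₆.4cT²≡ ⟩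
      X₁₆                         ∎
    combined : + 5 * (+ 16 * X₁) + + 4 * X₁₆ ≡ + 5 * (+ 4 * X₄) + + 4 * (+ 16 * X₁) [mod p ]
    combined = mod-+ (mod-*ˡ (+ 5) 16X₁≡4X₄) (mod-*ˡ (+ 4) (mod-sym 16X₁≡X₁₆))
    combination : ∀ ε →
      (+ 5 * (+ 16 * ((ε + + 1) * (ε + + 1))) + + 4 * ((ε + + 16) * (ε + + 16)))
        - (+ 5 * (+ 4 * ((ε + + 4) * (ε + + 4))) + + 4 * (+ 16 * ((ε + + 1) * (ε + + 1))))
      ≡ + 720
    combination = solve-∀

  ShiftedSquareFor : ℤ → Set
  ShiftedSquareFor T = ∃ λ t → t ℕ.≤ h × T * T ≡ + t * + t [mod p ] × shifted t ∈ Squares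

  shiftedSquare : ∀ T S → T * T - S * S ≡ ε [mod p ] → ShiftedSquareFor T
  shiftedSquare T S T²-S²≡ε with smallRoot T | smallRoot S
  ... | t , t≤h , T²≡t² | s , s≤h , S²≡s² =
    t , t≤h , T²≡t² , subst (_∈ Squares) (sym (mod⇒residue≡ t²-ε≡s²)) (∈Squares s≤h)
    where
    t²-ε≡s² : + t * + t - ε ≡ + s * + s [mod p ]
    t²-ε≡s² = begin
      + t * + t - ε                ≈⟨ mod-+ T²≡t² (mod-neg T²-S²≡ε) ⟨
      T * T - (T * T - S * S)      ≡⟨ cancel (T * T) (S * S) ⟩
      S * S                        ≈⟨ S²≡s² ⟩
      + s * + s                    ∎
      where open ModReasoning p
            cancel : ∀ x y → x - (x - y) ≡ y
            cancel = solve-∀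

  sameShift : ∀ t t′ → shifted t ≡ shifted t′ → + t * + t ≡ + t′ * + t′ [mod p ]
  sameShift t t′ same = begin
    + t * + t                  ≡⟨ restore (+ t * + t) ε ⟨
    (+ t * + t - ε) + ε        ≈⟨ mod-+ shifts≡ (mod-reflexive refl) ⟩
    (+ t′ * + t′ - ε) + ε      ≡⟨ restore (+ t′ * + t′) ε ⟩
    + t′ * + t′                ∎
    where open ModReasoning p
          shifts≡ : + t * + t - ε ≡ + t′ * + t′ - ε [mod p ]
          shifts≡ = residue≡⇒mod same
          restore : ∀ x ε → (x - ε) + ε ≡ x
          restore = solve-∀

  TwoShiftedSquares : Set
  TwoShiftedSquares = ∃₂ λ x y → x ∈ Shifted × y ∈ Shifted × x ∈ Squares × y ∈ Squares × x ≢ y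

  pickTwo : ShiftedSquareFor R₁.T → ShiftedSquareFor R₄.T → ShiftedSquareFor R₁₆.T →
            TwoShiftedSquares
  pickTwo (t₁ , t₁≤h , T₁²≡t₁² , sq₁) (t₄ , t₄≤h , T₄²≡t₄² , sq₄) (t₁₆ , t₁₆≤h , T₁₆²≡t₁₆² , sq₁₆)
    with shifted t₁ ℕ.≟ shifted t₄ | shifted t₁ ℕ.≟ shifted t₁₆
  ... | no ≢₄ | _ = _ , _ , ∈Shifted t₁≤h , ∈Shifted t₄≤h , sq₁ , sq₄ , ≢₄
  ... | yes _ | no ≢₁₆ = _ , _ , ∈Shifted t₁≤h , ∈Shifted t₁₆≤h , sq₁ , sq₁₆ , ≢₁₆
  ... | yes ≡₄ | yes ≡₁₆ = ⊥-elim (noTripleCollision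
          (mod-trans T₁²≡t₁² (mod-trans (sameShift t₁ t₄ ≡₄) (mod-sym T₄²≡t₄²)))
          (mod-trans T₁²≡t₁² (mod-trans (sameShift t₁ t₁₆ ≡₁₆) (mod-sym T₁₆²≡t₁₆²))))

  twoShiftedSquares : TwoShiftedSquares
  twoShiftedSquares = pickTwo (shiftedSquare R₁.T R₁.S R₁.T²-S²≡ε)
                              (shiftedSquare R₄.T R₄.S R₄.T²-S²≡ε)
                              (shiftedSquare R₁₆.T R₁₆.S R₁₆.T²-S²≡ε)

  fewResidues : ∀ rest → length Shifted ≡ 2 ℕ.+ length rest → length (Squares ++ rest) ℕ.< p
  fewResidues rest shorter = begin-strict
    length (Squares ++ rest)          ≡⟨ LP.length-++ Squares ⟩
    length Squares ℕ.+ length rest    ≡⟨ cong (ℕ._+ length rest) (tableLength square) ⟩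
    suc h ℕ.+ length rest             ≡⟨ ℕP.+-suc h (length rest) ⟨
    h ℕ.+ suc (length rest)           ≡⟨ cong (h ℕ.+_) h≡1+rest ⟨
    h ℕ.+ h                           <⟨ ℕP.n<1+n (h ℕ.+ h) ⟩
    suc (h ℕ.+ h)                     ≡⟨ p≡2h+1 ⟨
    p                                 ∎
    where
    open ℕP.≤-Reasoning
    tableLength : ∀ f → length (map f (upTo (suc h))) ≡ suc h
    tableLength f = trans (LP.length-map f (upTo (suc h))) (LP.length-upTo (suc h))
    h≡1+rest : h ≡ suc (length rest)
    h≡1+rest = ℕP.suc-injective (trans (sym (tableLength shifted)) shorter)

  -- a residue outside Squares and outside Shifted minus the two squares found above
  nonSquarePair : TwoShiftedSquares → ∃ λ w → NonSquare p w × NonSquare p (w + ε)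
  nonSquarePair (x , y , x∈Sh , y∈Sh , x∈Sq , y∈Sq , x≢y) with removeTwo x∈Sh y∈Sh x≢y
  ... | rest , shorter , keep with missingValue p (Squares ++ rest) (fewResidues rest shorter)
  ... | w , w<p , w∉ = + w , nonSquare w<p (λ w∈Sq → w∉ (∈-++⁺ˡ w∈Sq))
                           , shiftedNonSquare w<p w∉Shifted
    where
    notSquare : ∀ {z} → z ∈ Squares → w ≢ z
    notSquare z∈Sq refl = w∉ (∈-++⁺ˡ z∈Sq)
    w∉Shifted : w ∉ Shifted
    w∉Shifted w∈Sh = w∉ (∈-++⁺ʳ Squares (keep w∈Sh (notSquare x∈Sq) (notSquare y∈Sq)))

  twoNonSquares : ∃ λ w → NonSquare p w × NonSquare p (w + ε)
  twoNonSquares = nonSquarePair twoShiftedSquares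

Increasing : ∀ {κ} → (Fin κ → ℤ) → Set
Increasing f = ∀ i j → i Fin.< j → f i < f j

increasing⇒injective : ∀ {κ} {f : Fin κ → ℤ} → Increasing f → ∀ {i j} → f i ≡ f j → i ≡ j
increasing⇒injective f↑ {i} {j} fi≡fj with FinP.<-cmp i j
... | tri< i<j _ _ = ⊥-elim (ℤP.<-irrefl fi≡fj (f↑ i j i<j))
... | tri≈ _ i≡j _ = i≡j
... | tri> _ _ j<i = ⊥-elim (ℤP.<-irrefl (sym fi≡fj) (f↑ j i j<i))

admissible-twoFamilies : ∀ {κ} (α β : ℕ) (f g : Fin κ → ℤ) → 0 ℕ.< β → β ℕ.< α →
  Increasing f → Increasing g →
  ((p : ℕ) → Prime p →
     ∃ λ n → (∀ i → ¬ + p ∣ₛ (+ α * n + f i)) × (∀ i → ¬ + p ∣ₛ (+ β * n + g i))) →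
  Admissible (tabulate (λ i → (+ α , f i)) ++ tabulate (λ i → (+ β , g i)))
admissible-twoFamilies α β f g 0<β β<α f↑ g↑ avoid = distinct , positive , primeAvoided
  where
  Ls : List LinFun
  Ls = tabulate (λ i → (+ α , f i)) ++ tabulate (λ i → (+ β , g i))
  distinct : Unique Ls
  distinct = UniqueP.++⁺ (UniqueP.tabulate⁺ (λ same → increasing⇒injective f↑ (cong proj₂ same)))
                         (UniqueP.tabulate⁺ (λ same → increasing⇒injective g↑ (cong proj₂ same)))
                         (λ (inFirst , inSecond) → ℕP.<-irrefl
                            (ℤP.+-injective (trans (sym (cong proj₁ (proj₂ (∈-tabulate⁻ inSecond))))
                                                   (cong proj₁ (proj₂ (∈-tabulate⁻ inFirst)))))
                            β<α)
  positive : All (λ L → + 0 < proj₁ L) Ls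
  positive = AllP.++⁺ (AllP.tabulate⁺ {f = λ i → (+ α , f i)} (λ _ → ℤ.+<+ (ℕP.<-trans 0<β β<α)))
                      (AllP.tabulate⁺ {f = λ i → (+ β , g i)} (λ _ → ℤ.+<+ 0<β))
  primeAvoided : (p : ℕ) → Prime p → ∃ λ n → ¬ + p ∣ prodℤ (map (λ L → evalLin L n) Ls)
  primeAvoided p pr with avoid p pr
  ... | n , firstAvoided , secondAvoided = n , λ p∣ → prime∤prodℤ pr
          (AllP.map⁺ (AllP.++⁺ (AllP.tabulate⁺ firstAvoided) (AllP.tabulate⁺ secondAvoided)))
          (∣ᵤ⇒∣ p∣)

offsetBound : ∀ T v K → T ℕ.≤ 8 → 1 ℕ.≤ K →
              T ℕ.* (15 ℕ.* v) ℕ.* (K ℕ.* K) ℕ.≤ v ℕ.* ((2 ℕ.* K) ℕ.^ 7)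
offsetBound T v K T≤8 1≤K = begin
  T ℕ.* (15 ℕ.* v) ℕ.* (K ℕ.* K)         ≤⟨ ℕP.*-monoˡ-≤ (K ℕ.* K) (ℕP.*-monoˡ-≤ (15 ℕ.* v) T≤8) ⟩
  8 ℕ.* (15 ℕ.* v) ℕ.* (K ℕ.* K)         ≡⟨ regroup v K ⟩
  v ℕ.* (120 ℕ.* (K ℕ.* K) ℕ.* 1)        ≤⟨ ℕP.*-monoʳ-≤ v (ℕP.*-mono-≤ 120≤128 1≤K⁵) ⟩
  v ℕ.* (128 ℕ.* (K ℕ.* K) ℕ.* K ℕ.^ 5)  ≡⟨ powers v K ⟩
  v ℕ.* (2 ℕ.* K) ℕ.^ 7                  ∎
  where
  open ℕP.≤-Reasoning
  120≤128 : 120 ℕ.* (K ℕ.* K) ℕ.≤ 128 ℕ.* (K ℕ.* K)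
  120≤128 = ℕP.*-monoˡ-≤ (K ℕ.* K) (ℕP.m≤m+n 120 8)
  1≤K⁵ : 1 ℕ.≤ K ℕ.^ 5
  1≤K⁵ = ℕP.^-monoˡ-≤ 5 1≤K
  regroup : ∀ v K → 8 ℕ.* (15 ℕ.* v) ℕ.* (K ℕ.* K) ≡ v ℕ.* (120 ℕ.* (K ℕ.* K) ℕ.* 1)
  regroup = ℕSolver.solve-∀
  -- the powers unfold definitionally to iterated products
  powers : ∀ v K → v ℕ.* (128 ℕ.* (K ℕ.* K) ℕ.* (K ℕ.* (K ℕ.* (K ℕ.* (K ℕ.* (K ℕ.* 1))))))
                 ≡ v ℕ.* (2 ℕ.* K ℕ.* (2 ℕ.* K ℕ.* (2 ℕ.* K ℕ.* (2 ℕ.* K ℕ.*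
                          (2 ℕ.* K ℕ.* (2 ℕ.* K ℕ.* (2 ℕ.* K ℕ.* 1)))))))
  powers = ℕSolver.solve-∀

module Construction (v T : ℕ) .{{_ : NonZero v}} .{{_ : NonZero T}}
  (T∣v : T ℕD.∣ v) (2∣T : 2 ℕD.∣ T) (u : ℤ) (u⊥v : Coprime ℤ.∣ u ∣ v)
  (T∣u-1 : + T ∣ₛ (u - + 1)) (b⊥v : Coprime ℤ.∣ (u - + 1) /ℕ T ∣ v) where

  open Residues T using (multiple/ℕ)

  b : ℤ
  b = (u - + 1) /ℕ T

  b*T≡u-1 : b * + T ≡ u - + 1
  b*T≡u-1 = trans (cong (λ x → x /ℕ T * + T) u-1≡q*T)
                  (trans (cong (_* + T) (multiple/ℕ q)) (sym u-1≡q*T))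
    where open _∣ₛ_ T∣u-1 renaming (quotient to q; equality to u-1≡q*T)

  v′ : ℕ
  v′ = v ℕ./ T

  v/T*T≡v : v′ ℕ.* T ≡ v
  v/T*T≡v = ℕDM.m/n*n≡m T∣v

  f e : ℕ
  f = 15 ℕ.* v
  e = T ℕ.* f

  square : ∀ {κ} → Fin κ → ℕ
  square i = suc (toℕ i) ℕ.* suc (toℕ i)

  a : ∀ {κ} → Fin κ → ℤ
  a i = u + + (e ℕ.* square i)

  ã : ∀ {κ} → Fin κ → ℤ
  ã i = (a i - + 1) /ℕ T

  a-1≡ : ∀ {κ} (i : Fin κ) → a i - + 1 ≡ (b + + (f ℕ.* square i)) * + T
  a-1≡ i = begin
    (u + + (e ℕ.* square i)) - + 1          ≡⟨ cong (λ x → (u + + x) - + 1) (ℕP.*-assoc T f _) ⟩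
    (u + + (T ℕ.* (f ℕ.* square i))) - + 1  ≡⟨ cong (λ x → (u + x) - + 1) (ℤP.pos-* T _) ⟩
    (u + + T * + (f ℕ.* square i)) - + 1    ≡⟨ rearrange u (+ T) (+ (f ℕ.* square i)) ⟩
    (u - + 1) + + (f ℕ.* square i) * + T     ≡⟨ cong (_+ + (f ℕ.* square i) * + T) b*T≡u-1 ⟨
    b * + T + + (f ℕ.* square i) * + T       ≡⟨ ℤP.*-distribʳ-+ (+ T) b _ ⟨
    (b + + (f ℕ.* square i)) * + T           ∎
    where open ≡-Reasoning
          rearrange : ∀ u t x → (u + t * x) - + 1 ≡ (u - + 1) + x * t
          rearrange = solve-∀

  ã≡ : ∀ {κ} (i : Fin κ) → ã i ≡ b + + (f ℕ.* square i)
  ã≡ i = trans (cong (_/ℕ T) (a-1≡ i)) (multiple/ℕ _)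

  instance
    f≢0 : NonZero f
    f≢0 = ℕP.m*n≢0 15 v
    e≢0 : NonZero e
    e≢0 = ℕP.m*n≢0 T f

  increasing : ∀ {κ} c d .{{_ : NonZero d}} → Increasing {κ} (λ i → c + + (d ℕ.* square i))
  increasing c d i j i<j = ℤP.+-monoʳ-< c (ℤ.+<+ (ℕP.*-monoʳ-< d (ℕP.*-mono-< (s≤s i<j) (s≤s i<j))))

  a↑ : ∀ {κ} → Increasing {κ} a
  a↑ = increasing u e

  ã↑ : ∀ {κ} → Increasing {κ} ã
  ã↑ i j i<j = subst₂ _<_ (sym (ã≡ i)) (sym (ã≡ j)) (increasing b f i j i<j)

  v∣e : v ℕD.∣ e
  v∣e = ℕD.∣-trans (ℕD.n∣m*n 15) (ℕD.n∣m*n T)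

  15∣e : 15 ℕD.∣ e
  15∣e = ℕD.∣-trans (ℕD.m∣m*n v) (ℕD.n∣m*n T)

  v∣a-u : ∀ {κ} (i : Fin κ) → + v ∣ₛ (a i - u)
  v∣a-u i = subst (+ v ∣ₛ_) (sym (cancel u (+ (e ℕ.* square i))))
                  (∣ᵤ⇒∣ (ℕD.∣-trans v∣e (ℕD.m∣m*n (square i))))
    where cancel : ∀ u x → (u + x) - u ≡ x
          cancel = solve-∀

  L L̃ : ∀ {κ} → Fin κ → ℤ → ℤ
  L i n = + v * n + a i
  L̃ i n = + v′ * n + ã i

  T*L̃≡L-1 : ∀ {κ} (i : Fin κ) n → + T * L̃ i n ≡ L i n - + 1
  T*L̃≡L-1 i n = begin
    + T * (+ v′ * n + ã i)          ≡⟨ distribute (+ T) (+ v′) n (ã i) ⟩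
    + v′ * + T * n + ã i * + T      ≡⟨ cong₂ (λ x y → x * n + y) v′*T≡v ã*T≡a-1 ⟩
    + v * n + (a i - + 1)           ≡⟨ ℤP.+-assoc (+ v * n) (a i) (- + 1) ⟨
    + v * n + a i - + 1             ∎
    where
    open ≡-Reasoning
    distribute : ∀ t w n x → t * (w * n + x) ≡ w * t * n + x * t
    distribute = solve-∀
    v′*T≡v : + v′ * + T ≡ + v
    v′*T≡v = trans (sym (ℤP.pos-* v′ T)) (cong +_ v/T*T≡v)
    ã*T≡a-1 : ã i * + T ≡ a i - + 1
    ã*T≡a-1 = trans (cong (_* + T) (ã≡ i)) (sym (a-1≡ i))

  Avoids : ℕ → ℕ → Set
  Avoids κ p = ∃ λ n → (∀ (i : Fin κ) → ¬ + p ∣ₛ L i n) × (∀ (i : Fin κ) → ¬ + p ∣ₛ L̃ i n)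

  atZero : ∀ α x → + α * + 0 + x ≡ x
  atZero α x = trans (cong (_+ x) (ℤP.*-zeroʳ (+ α))) (ℤP.+-identityˡ x)

  -- a prime p ∣ v misses both families at n = 0: there Lᵢ ≡ u and L̃ᵢ ≡ b, both coprime to v
  avoid-∣v : ∀ {κ p} → Prime p → p ℕD.∣ v → Avoids κ p
  avoid-∣v {p = p} pr p∣v = + 0 , L∤ , L̃∤
    where
    p∣multiple : ∀ d → v ℕD.∣ d → ∀ s → + p ∣ₛ + (d ℕ.* s)
    p∣multiple d v∣d s = ∣ᵤ⇒∣ (ℕD.∣-trans p∣v (ℕD.∣-trans v∣d (ℕD.m∣m*n s)))
    L∤ : ∀ i → ¬ + p ∣ₛ L i (+ 0)
    L∤ i p∣L = coprime⇒∤ pr u⊥v p∣v (∣-resp-mod L≡u p∣L)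
      where L≡u : L i (+ 0) ≡ u [mod p ]
            L≡u = mod-trans (mod-reflexive (atZero v (a i)))
                            (absorb u (p∣multiple e v∣e (square i)))
    L̃∤ : ∀ i → ¬ + p ∣ₛ L̃ i (+ 0)
    L̃∤ i p∣L̃ = coprime⇒∤ pr b⊥v p∣v (∣-resp-mod L̃≡b p∣L̃)
      where L̃≡b : L̃ i (+ 0) ≡ b [mod p ]
            L̃≡b = mod-trans (mod-reflexive (trans (atZero v′ (ã i)) (ã≡ i)))
                            (absorb b (p∣multiple f (ℕD.n∣m*n 15) (square i)))

  -- For a prime p ∤ v, n ≡ v⁻¹(c - u) moves every Lᵢ(n) to c + e(i+1)², and p misses
  -- L̃ᵢ(n) as soon as it misses Lᵢ(n) - 1 = T·L̃ᵢ(n).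
  module CoprimeToV {p} (pr : Prime p) (p∤v : ¬ p ℕD.∣ v) where

    v⁻¹ : ℤ
    v⁻¹ = proj₁ (inverseMod pr v p∤v)

    vv⁻¹≡1 : + v * v⁻¹ ≡ + 1 [mod p ]
    vv⁻¹≡1 = proj₂ (inverseMod pr v p∤v)

    shiftTo : ∀ {κ} c (i : Fin κ) → L i (v⁻¹ * (c - u)) ≡ c + + (e ℕ.* square i) [mod p ]
    shiftTo c i = begin
      + v * (v⁻¹ * (c - u)) + (u + X)    ≡⟨ regroup (+ v) v⁻¹ c u X ⟩
      + v * v⁻¹ * (c - u) + (u + X)      ≈⟨ mod-+ (mod-*ʳ (c - u) vv⁻¹≡1) (mod-reflexive refl) ⟩
      + 1 * (c - u) + (u + X)            ≡⟨ simplify c u X ⟩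
      c + X                              ∎
      where
      open ModReasoning p
      X : ℤ
      X = + (e ℕ.* square i)
      regroup : ∀ v w c u x → v * (w * (c - u)) + (u + x) ≡ v * w * (c - u) + (u + x)
      regroup = solve-∀
      simplify : ∀ c u x → + 1 * (c - u) + (u + x) ≡ c + x
      simplify = solve-∀

    avoidBoth : ∀ {κ} n → (∀ (i : Fin κ) → ¬ + p ∣ₛ L i n × ¬ + p ∣ₛ (L i n - + 1)) → Avoids κ p
    avoidBoth n avoid = n , (λ i → proj₁ (avoid i)) ,
      λ i p∣L̃ → proj₂ (avoid i) (subst (+ p ∣ₛ_) (T*L̃≡L-1 i n) (∣n⇒∣m*n (+ T) p∣L̃))

    p∤2 : ¬ p ℕD.∣ 2
    p∤2 p∣2 = p∤v (ℕD.∣-trans p∣2 (ℕD.∣-trans 2∣T T∣v))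

    -- if p ∣ 15 then p ∣ e, and n = v⁻¹(2 - u) gives Lᵢ(n) ≡ 2
    avoid-∣15 : ∀ {κ} → p ℕD.∣ 15 → Avoids κ p
    avoid-∣15 p∣15 = avoidBoth n (λ i → (λ p∣L → p∤2 (∣⇒∣ᵤ (∣-resp-mod (L≡2 i) p∣L))) ,
                                        (λ p∣L-1 → prime∤1 pr (∣-resp-mod (L-1≡1 i) p∣L-1)))
      where
      n : ℤ
      n = v⁻¹ * (+ 2 - u)
      p∣offset : ∀ s → + p ∣ₛ + (e ℕ.* s)
      p∣offset s = ∣ᵤ⇒∣ (ℕD.∣-trans p∣15 (ℕD.∣-trans 15∣e (ℕD.m∣m*n s)))
      L≡2 : ∀ {κ} (i : Fin κ) → L i n ≡ + 2 [mod p ]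
      L≡2 i = mod-trans (shiftTo (+ 2) i) (absorb (+ 2) (p∣offset (square i)))
      L-1≡1 : ∀ {κ} (i : Fin κ) → L i n - + 1 ≡ + 1 [mod p ]
      L-1≡1 i = mod-+ (L≡2 i) (mod-reflexive refl)

    -- if p ∤ 15, take ε ≡ e⁻¹ and w with w, w + ε non-squares; then n = v⁻¹(-ew - u)
    -- gives Lᵢ(n) ≡ e((i+1)² - w) and Lᵢ(n) - 1 ≡ e((i+1)² - (w + ε)), both prime to p
    avoid-∤15 : ∀ {κ} → ¬ p ℕD.∣ 15 → Avoids κ p
    avoid-∤15 p∤15 = avoidBoth n (λ i → L∤ i , L-1∤ i)
      where
      p∤e : ¬ p ℕD.∣ e
      p∤e = prime∤*ℕ pr (λ p∣T → p∤v (ℕD.∣-trans p∣T T∣v)) (prime∤*ℕ pr p∤15 p∤v)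
      ε : ℤ
      ε = proj₁ (inverseMod pr e p∤e)
      eε≡1 : + e * ε ≡ + 1 [mod p ]
      eε≡1 = proj₂ (inverseMod pr e p∤e)
      h : ℕ
      h = proj₁ (oddPrime pr p∤2)
      open TwoNonSquares p h (proj₂ (oddPrime pr p∤2)) pr p∤2
             (λ p∣3 → p∤15 (ℕD.∣-trans p∣3 (ℕD.divides 5 refl)))
             (λ p∣5 → p∤15 (ℕD.∣-trans p∣5 (ℕD.divides 3 refl))) ε
             using (twoNonSquares)
      w : ℤ
      w = proj₁ twoNonSquares
      n : ℤ
      n = v⁻¹ * (- (+ e * w) - u)
      K : ∀ {κ} → Fin κ → ℤ
      K i = + suc (toℕ i)
      offset≡ : ∀ {κ} (i : Fin κ) → + (e ℕ.* square i) ≡ + e * (K i * K i)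
      offset≡ i = trans (ℤP.pos-* e (square i))
                        (cong (+ e *_) (ℤP.pos-* (suc (toℕ i)) (suc (toℕ i))))
      L≡ : ∀ {κ} (i : Fin κ) → L i n ≡ + e * (K i * K i - w) [mod p ]
      L≡ i = begin
        L i n                                 ≈⟨ shiftTo (- (+ e * w)) i ⟩
        - (+ e * w) + + (e ℕ.* square i)      ≡⟨ cong (λ x → - (+ e * w) + x) (offset≡ i) ⟩
        - (+ e * w) + + e * (K i * K i)       ≡⟨ factor (+ e) w (K i * K i) ⟩
        + e * (K i * K i - w)                 ∎
        where open ModReasoning p
              factor : ∀ e w s → - (e * w) + e * s ≡ e * (s - w)
              factor = solve-∀
      L-1≡ : ∀ {κ} (i : Fin κ) → L i n - + 1 ≡ + e * (K i * K i - (w + ε)) [mod p ]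
      L-1≡ i = begin
        L i n - + 1                            ≈⟨ mod-+ (L≡ i) (mod-neg (mod-sym eε≡1)) ⟩
        + e * (K i * K i - w) - + e * ε        ≡⟨ factor (+ e) w ε (K i * K i) ⟩
        + e * (K i * K i - (w + ε))            ∎
        where open ModReasoning p
              factor : ∀ e w ε s → e * (s - w) - e * ε ≡ e * (s - (w + ε))
              factor = solve-∀
      p∤e′ : ¬ + p ∣ₛ + e
      p∤e′ p∣e = p∤e (∣⇒∣ᵤ p∣e)
      L∤ : ∀ {κ} (i : Fin κ) → ¬ + p ∣ₛ L i n
      L∤ i p∣L = prime∤* pr p∤e′ (λ p∣ → proj₁ (proj₂ twoNonSquares) (K i) (congruent p∣))
                   (∣-resp-mod (L≡ i) p∣L)
      L-1∤ : ∀ {κ} (i : Fin κ) → ¬ + p ∣ₛ (L i n - + 1)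
      L-1∤ i p∣L-1 = prime∤* pr p∤e′ (λ p∣ → proj₂ (proj₂ twoNonSquares) (K i) (congruent p∣))
                       (∣-resp-mod (L-1≡ i) p∣L-1)

  avoid : ∀ κ p → Prime p → Avoids κ p
  avoid κ p pr with p ℕD.∣? v
  ... | yes p∣v = avoid-∣v pr p∣v
  ... | no p∤v with p ℕD.∣? 15
  ...   | yes p∣15 = CoprimeToV.avoid-∣15 pr p∤v p∣15
  ...   | no p∤15 = CoprimeToV.avoid-∤15 pr p∤v p∤15

  spread-bound : T ℕ.≤ 8 → ∀ κ → spread κ a ≤ + (v ℕ.* ((2 ℕ.* κ) ℕ.^ 7))
  spread-bound T≤8 zero = ℤ.+≤+ z≤n
  spread-bound T≤8 (suc k) = begin
    a last - a first                           ≡⟨ cancel u (+ (e ℕ.* square last)) (+ (e ℕ.* 1)) ⟩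
    + (e ℕ.* square last) - + (e ℕ.* 1)        ≤⟨ ℤP.i-j≤i (+ (e ℕ.* square last)) (+ (e ℕ.* 1)) ⟩
    + (e ℕ.* square last)                      ≡⟨ cong (λ K → + (e ℕ.* (suc K ℕ.* suc K))) last≡k ⟩
    + (e ℕ.* (suc k ℕ.* suc k))                ≤⟨ ℤ.+≤+ (offsetBound T v (suc k) T≤8 (s≤s z≤n)) ⟩
    + (v ℕ.* ((2 ℕ.* suc k) ℕ.^ 7))            ∎
    where
    open ℤP.≤-Reasoning
    first last : Fin (suc k)
    first = Fin.zero
    last = Fin.fromℕ k
    last≡k : toℕ last ≡ k
    last≡k = FinP.toℕ-fromℕ k
    cancel : ∀ u x y → (u + x) - (u + y) ≡ x - y
    cancel = solve-∀

  0<v′ : 0 ℕ.< v′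
  0<v′ = ℕDM.m≥n⇒m/n>0 (ℕD.∣⇒≤ T∣v)

  v′<v : v′ ℕ.< v
  v′<v = ℕDM.m/n<m v T (ℕD.∣⇒≤ 2∣T)

  properties : T ℕ.≤ 8 → ∀ κ →
    ((i j : Fin κ) → i Fin.< j → a i < a j) ×
    ((i : Fin κ) → + v ∣ (a i - u)) ×
    Admissible (tabulate (λ (i : Fin κ) → (+ v , a i)) ++ tabulate (λ (i : Fin κ) → (+ v′ , ã i))) ×
    (spread κ a ≤ + (v ℕ.* ((2 ℕ.* κ) ℕ.^ 7)))
  properties T≤8 κ = a↑ , (λ i → ∣⇒∣ᵤ (v∣a-u i)) ,
    admissible-twoFamilies v v′ (a {κ}) ã 0<v′ v′<v a↑ ã↑ (avoid κ) , spread-bound T≤8 κ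

smallPowerOfTwo : ∀ {T} → T ≡ 2 ⊎ T ≡ 4 ⊎ T ≡ 8 → 2 ℕD.∣ T × T ℕD.∣ 16 × T ℕ.≤ 8
smallPowerOfTwo (inj₁ refl)        = ℕD.divides 1 refl , ℕD.divides 8 refl , ℕP.m≤m+n 2 6
smallPowerOfTwo (inj₂ (inj₁ refl)) = ℕD.divides 2 refl , ℕD.divides 4 refl , ℕP.m≤m+n 4 4
smallPowerOfTwo (inj₂ (inj₂ refl)) = ℕD.divides 4 refl , ℕD.divides 2 refl , ℕP.≤-refl

oddRad≥1 : ∀ Q → 1 ℕ.≤ oddRad Q
oddRad≥1 Q = productOfPrimes≥1 (All.map (λ (_ , ℓ-prime , _) → ℓ-prime)
  (AllP.all-filter (λ ℓ → (2 ℕ.<? ℓ) ×-dec (prime? ℓ ×-dec (ℓ ℕD.∣? Q))) (upTo (suc Q))))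

lemma2p3 : ∃ λ (C₁ : ℕ) → (0 ℕ.< C₁) ×
    ((r : ℕ) (q : Fin r → ℤ) → ((i : Fin r) → ¬ (q i ≡ + 0)) →
      ((e : Fin (suc r) → ℕ) →
        IsSquare ((-[1+ 2 ] ^ e Fin.zero) * prodℤ (tabulate (λ i → q i ^ e (Fin.suc i)))) →
        2 Data.Nat.Divisibility.∣ sum (tabulate e)) →
      (v : ℕ) → v ≡ 16 ℕ.* oddRad (Data.Nat.ListAction.product (tabulate (λ i → ∣ q i ∣))) →
      (u : ℤ) → Coprime ∣ u ∣ v →
      ((p : ℕ) → Prime p → (+ v) ∣ (+ p - u) → (i : Fin r) → LegendreIsMinusOne (q i) p) →
      (T : ℕ) .{{_ : NonZero T}} → (T ≡ 2 ⊎ T ≡ 4 ⊎ T ≡ 8) →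
      (+ T) ∣ (u - + 1) → ¬ ((+ (2 ℕ.* T)) ∣ (u - + 1)) →
      Coprime ∣ (u - + 1) /ℕ T ∣ v →
      (κ : ℕ) → ∃ λ (a : Fin κ → ℤ) →
        ((i j : Fin κ) → i Fin.< j → a i < a j) ×
        ((i : Fin κ) → (+ v) ∣ (a i - u)) ×
        Admissible (tabulate (λ i → (+ v , a i)) ++
                    tabulate (λ i → (+ (v ℕ./ T) , (a i - + 1) /ℕ T))) ×
        (spread κ a ≤ + (v ℕ.* ((2 ℕ.* κ) ℕ.^ C₁))))
lemma2p3 = 7 , s≤s z≤n , λ r q _ _ v v≡16R u u⊥v _ T T∈ T∣u-1 _ b⊥v κ →
  let Q : ℕ
      Q = Data.Nat.ListAction.product (tabulate (λ i → ∣ q i ∣))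
      R : ℕ
      R = oddRad Q
      (2∣T , T∣16 , T≤8) = smallPowerOfTwo T∈
      16∣v : 16 ℕD.∣ v
      16∣v = subst (16 ℕD.∣_) (sym v≡16R) (ℕD.m∣m*n R)
      v≢0 : NonZero v
      v≢0 = subst NonZero (sym v≡16R) (ℕP.m*n≢0 16 R {{_}} {{ℕ.>-nonZero (oddRad≥1 Q)}})
      open Construction v T {{v≢0}} (ℕD.∣-trans T∣16 16∣v) 2∣T u u⊥v (∣ᵤ⇒∣ T∣u-1) b⊥v
  in a , properties T≤8 κ
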